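{- Let $M=\{1^{p_1},\dots,n^{p_n}\}$ be a multiset with $p_1,\dots,p_n$ positive integers. For every $T\in\mathcal{T}_M$, $\mathsf{odd}(T)=\mathsf{oe}(\widehat{T})$, where $T\mapsto\widehat T$ is the map defined in the context.
   Context: A plane tree is a rooted tree in which the children of every node are linearly ordered (left to right). With $p=p_1+\cdots+p_n$, a weakly increasing tree on $M$ is a plane tree with $p+1$ nodes labeled by the elements of the multiset $M\cup\{0\}$ (with multiplicity) such that labels weakly increase along every root-to-leaf path and the labels of the children of each node weakly increase from left to right. $\mathcal{T}_M$ is the set of such trees. The degree of a node is its number of children; the level of a node is its distance from the root (root at level $0$). $\mathsf{odd}(T)$ is the number of nodes of odd degree in $T$; $\mathsf{oe}(T)$ is the number of nodes of even degree lying on odd levels of $T$. The map $T\mapsto\widehat T$ is defined recursively on labeled plane trees whose labels weakly increase along root-to-leaf paths and among siblings from left to right: if $T$ is a single node, $\widehat T=T$. Otherwise let $r$ be the root label, $v$ the leftmost child of the root with label $c$, $H$ the subtree formed by $v$ and its descendants, and $u_1,\dots,u_s$ the other children of the root from left to right with subtrees $T_{u_i}$. Then $\widehat T$ is obtained from $\widehat H$ (root labeled $c$) by relabeling its root $r$, attaching a new node labeled $c$ as the leftmost child of this root, and attaching $\widehat{T_{u_1}},\dots,\widehat{T_{u_s}}$ from left to right as the (only) subtrees of the new node $c$. -}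

module Defs where

open import Data.Nat using (ℕ; zero; suc; _+_; _≤_; _<_)
open import Data.Bool using (Bool; true; false; not; if_then_else_)
open import Data.Fin using (Fin; toℕ)
open import Data.List using (List; []; _∷_; length; replicate; concatMap; allFin)
open import Data.List.Relation.Unary.All using (All)
open import Data.List.Relation.Unary.Linked using (Linked)
open import Data.List.Relation.Binary.Permutation.Propositional using (_↭_)

data Tree : Set where
  node : ℕ → List Tree → Tree

label : Tree → ℕ
label (node r _) = r

children : Tree → List Tree
children (node _ cs) = cs

degree : Tree → ℕ
degree t = length (children t)

mutual
  labels : Tree → List ℕ
  labels (node r cs) = r ∷ labelsF cs

  labelsF : List Tree → List ℕ
  labelsF [] = []
  labelsF (t ∷ ts) = labels t Data.List.++ labelsF ts

data WeaklyIncreasing : Tree → Set where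
  wi : ∀ {r cs} →
       All (λ c → r ≤ label c) cs →
       Linked (λ a b → label a ≤ label b) cs →
       All WeaklyIncreasing cs →
       WeaklyIncreasing (node r cs)

-- the multiset M ∪ {0} with M = {1^{p_1}, …, n^{p_n}}, as a list
multisetList : (n : ℕ) → (Fin n → ℕ) → List ℕ
multisetList n p = 0 ∷ concatMap (λ i → replicate (p i) (suc (toℕ i))) (allFin n)

record InTM (n : ℕ) (p : Fin n → ℕ) (T : Tree) : Set where
  field
    labelsOK : labels T ↭ multisetList n p
    increasing : WeaklyIncreasing T

isOdd : ℕ → Bool
isOdd zero = false
isOdd (suc k) = not (isOdd k)

b2n : Bool → ℕ
b2n true = 1
b2n false = 0

mutual
  oddCount : Tree → ℕ
  oddCount (node r cs) = b2n (isOdd (length cs)) + oddCountF cs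

  oddCountF : List Tree → ℕ
  oddCountF [] = 0
  oddCountF (t ∷ ts) = oddCount t + oddCountF ts

-- oe(T): number of nodes of even degree on odd levels (root at level 0).
-- The Bool argument records whether the current node is on an odd level.
mutual
  oeAt : Bool → Tree → ℕ
  oeAt lvlOdd (node r cs) =
    b2n (if lvlOdd then not (isOdd (length cs)) else false) + oeAtF (not lvlOdd) cs

  oeAtF : Bool → List Tree → ℕ
  oeAtF b [] = 0
  oeAtF b (t ∷ ts) = oeAt b t + oeAtF b ts

oe : Tree → ℕ
oe = oeAt false

mutual
  hat : Tree → Tree
  hat (node r []) = node r []
  hat (node r (v ∷ us)) = node r (node (label v) (hatF us) ∷ children (hat v))

  hatF : List Tree → List Tree
  hatF [] = []
  hatF (t ∷ ts) = hat t ∷ hatF ts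

module Submission where

-- In T̂ the root keeps the children of Ĥ at the same levels as in Ĥ,
-- so they contribute oe(Ĥ) = odd(H). The new node c sits on level 1 with degree s,
-- hence is counted by oe exactly when the root of T (of degree s + 1) has odd degree;
-- its subtrees T̂ᵤ hang at level 2, an even level, so they contribute oe(T̂ᵤ) = odd(Tᵤ).

open import Defs
open import Data.Nat using (ℕ; suc; _<_; _+_)
open import Data.Nat.Properties using (+-comm; +-assoc)
open import Data.Fin using (Fin)
open import Data.Bool using (true; false; not)
open import Data.List using ([]; _∷_; length)
open import Relation.Binary.PropositionalEquality using (_≡_; refl; cong; cong₂; sym; module ≡-Reasoning)

length-hatF : ∀ ts → length (hatF ts) ≡ length ts
length-hatF []       = refl
length-hatF (t ∷ ts) = cong suc (length-hatF ts)

oeAt-even≡oeAtF-odd-children : ∀ t → oeAt false t ≡ oeAtF true (children t)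
oeAt-even≡oeAtF-odd-children (node _ _) = refl

mutual
  oddCount≡oe∘hat : ∀ T → oddCount T ≡ oe (hat T)
  oddCount≡oe∘hat (node r [])       = refl
  oddCount≡oe∘hat (node r (v ∷ us)) = begin
    b2n (not (isOdd (length us))) + (oddCount v + oddCountF us)
      ≡⟨ cong (λ k → b2n (not (isOdd k)) + (oddCount v + oddCountF us)) (sym (length-hatF us)) ⟩
    a + (oddCount v + oddCountF us)
      ≡⟨ cong (a +_) (+-comm (oddCount v) (oddCountF us)) ⟩
    a + (oddCountF us + oddCount v)
      ≡⟨ sym (+-assoc a (oddCountF us) (oddCount v)) ⟩
    a + oddCountF us + oddCount v
      ≡⟨ cong (λ x → a + x + oddCount v) (oddCountF≡oeAtF-even∘hatF us) ⟩
    a + oeAtF false (hatF us) + oddCount v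
      ≡⟨ cong (a + oeAtF false (hatF us) +_) (oddCount≡oe∘hat v) ⟩
    a + oeAtF false (hatF us) + oe (hat v)
      ≡⟨ cong (a + oeAtF false (hatF us) +_) (oeAt-even≡oeAtF-odd-children (hat v)) ⟩
    a + oeAtF false (hatF us) + oeAtF true (children (hat v))
      ∎
    where
    open ≡-Reasoning
    a = b2n (not (isOdd (length (hatF us))))

  oddCountF≡oeAtF-even∘hatF : ∀ ts → oddCountF ts ≡ oeAtF false (hatF ts)
  oddCountF≡oeAtF-even∘hatF []       = refl
  oddCountF≡oeAtF-even∘hatF (t ∷ ts) =
    cong₂ _+_ (oddCount≡oe∘hat t) (oddCountF≡oeAtF-even∘hatF ts)

-- The identity holds for every labelled plane tree.
corollary1p3 : (n : ℕ) (p : Fin n → ℕ) → (∀ i → 0 < p i) →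
    (T : Tree) → InTM n p T → oddCount T ≡ oe (hat T)
corollary1p3 _ _ _ T _ = oddCount≡oe∘hat T
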